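{- Let $n$ be a positive integer and let $T_n = \{k : 2 \leq k \leq n-1,\ k \equiv n+1 \pmod 2\}$ (so $T_n = \{3,5,\ldots,n-1\}$ for even $n$, $T_n = \{2,4,\ldots,n-1\}$ for odd $n$, empty for $n \le 2$). For every $\pi \in \mathfrak{B}_n$ and every $k \in T_n$, $\mathsf{inv}_B(\mathrm{Sgn\_flip}_k(\pi)) \equiv \mathsf{inv}_B(\pi) \pmod 2$.
   Context: $\mathfrak{B}_n$ is the set of signed permutations of $[n]$, written as words $\pi = \pi_1,\ldots,\pi_n$ with $\pi_i \in \{\pm 1,\ldots,\pm n\}$ and $|\pi_1|,\ldots,|\pi_n|$ a permutation of $[n]$; $\overline{a}$ denotes $-a$. $\mathsf{Negs}(\pi) = \{\pi_i : \pi_i < 0\}$. The type B length is $\mathsf{inv}_B(\pi) = |\{1 \le i<j \le n : \pi_i > \pi_j\}| + |\{1 \le i<j \le n : -\pi_i > \pi_j\}| + |\mathsf{Negs}(\pi)|$. For $1 \leq k \leq n$, $\mathrm{Sgn\_flip}_k(\pi) = \pi_1,\ldots,\pi_{k-1},\overline{\pi_k},\ldots,\overline{\pi_n}$. -}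

module Defs where

open import Data.Nat using (ℕ; zero; suc; _+_; _≤_; _<_; _%_)
open import Data.Integer as ℤ using (ℤ; ∣_∣; -_)
open import Data.Fin using (Fin; toℕ)
open import Data.Fin.Properties using (all?)
open import Data.List using (List; length; filter; allFin; concatMap; map)
open import Data.Product using (_×_; _,_; Σ; ∃)
open import Relation.Binary.PropositionalEquality using (_≡_)
open import Relation.Nullary using (Dec; yes; no)
open import Relation.Nullary.Decidable using (_×-dec_)
import Data.Fin as F
open import Data.Fin.Properties using () renaming (_<?_ to _<F?_)
open import Function.Bundles using (Bijection)
open import Function using (_∘_)

-- A word of length n over ℤ: positions i ∈ Fin n (position i is π_{i+1}).
Word : ℕ → Set
Word n = Fin n → ℤ

IsSignedPerm : (n : ℕ) → Word n → Set
IsSignedPerm n π =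
  Σ (Fin n → Fin n) λ σ →
    (∀ i → ∣ π i ∣ ≡ suc (toℕ (σ i))) ×
    (∀ x y → σ x ≡ σ y → x ≡ y) × (∀ y → ∃ λ x → σ x ≡ y)

pairs : (n : ℕ) → List (Fin n × Fin n)
pairs n = filter (λ p → Data.Product.proj₁ p <F? Data.Product.proj₂ p)
                 (concatMap (λ i → map (λ j → (i , j)) (allFin n)) (allFin n))
  where import Data.Product

invB : (n : ℕ) → Word n → ℕ
invB n π =
    length (filter (λ p → π (proj₂ p) ℤ.<? π (proj₁ p)) (pairs n))
  + length (filter (λ p → π (proj₂ p) ℤ.<? - π (proj₁ p)) (pairs n))
  + length (filter (λ i → π i ℤ.<? ℤ.0ℤ) (allFin n))
  where open Data.Product using (proj₁; proj₂)
        import Data.Product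

-- Sgn_flip_k(π) = π_1,…,π_{k-1}, -π_k,…,-π_n  (1-based k; position i is
-- 0-based, so position i is negated iff i+1 ≥ k).
sgnFlip : (n : ℕ) → ℕ → Word n → Word n
sgnFlip n k π i with k Data.Nat.≤? suc (toℕ i)
... | yes _ = - π i
... | no  _ = π i
  where import Data.Nat

InT : ℕ → ℕ → Set
InT n k = 2 ≤ k × suc k ≤ n × k % 2 ≡ (n + 1) % 2

-- For a pair i < j, [π_j < π_i] + [π_j < -π_i] counts how many of ±π_i exceed π_j, which
-- is odd exactly when |π_j| < |π_i|; so modulo 2 the pair part of inv_B ignores signs and
-- Sgn_flip_k does not change it. Each of the n - k + 1 negated entries moves into or out
-- of Negs, so the negative count changes parity by n - k + 1, which is even precisely
-- for k ≡ n + 1 (mod 2).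
module Submission where

open import Defs
open import Data.Nat using (ℕ; _%_; _≤_)
open import Relation.Binary.PropositionalEquality using (_≡_)

open import Data.Bool using (true; false; if_then_else_)
open import Data.Empty using (⊥-elim)
open import Data.Fin as F using (Fin; toℕ)
import Data.Fin.Properties as FP
open import Data.Integer as ℤ using (ℤ; +[1+_]; -[1+_]; ∣_∣; -_; 0ℤ)
import Data.Integer.Properties as ℤP
open import Data.List using (List; []; _∷_; length; filter; map; concatMap; allFin; tabulate)
open import Data.List.Properties using (map-tabulate; tabulate-cong)
open import Data.List.Relation.Unary.All as All using (All; []; _∷_)
open import Data.List.Relation.Unary.All.Properties using (all-filter)
open import Data.Nat as N using (zero; suc; pred; _+_; _*_; _∸_; s≤s)
open import Data.Nat.DivMod using (%-distribˡ-+; [m+kn]%n≡m%n)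
open import Data.Nat.ListAction using (sum)
import Data.Nat.Properties as NP
open import Algebra.Properties.CommutativeSemigroup NP.+-commutativeSemigroup
  using (interchange)
open import Data.Product using (_×_; _,_; proj₁; proj₂)
open import Function using (_∘_; id; _⇔_; mk⇔)
open import Level using (Level; 0ℓ)
open import Relation.Binary using (IsEquivalence; Setoid)
import Relation.Binary.Reasoning.Setoid as SetoidReasoning
open import Relation.Binary.PropositionalEquality
  using (_≢_; refl; sym; trans; cong; cong₂; subst₂; module ≡-Reasoning)
open import Relation.Nullary using (Dec; yes; no; does; ¬_)
open import Relation.Nullary.Decidable using (does-⇔; dec-true; dec-false)
open import Relation.Unary using (Pred; Decidable)

private
  variable
    a b p : Level
    A : Set a
    B : Set b

infix 4 _≡₂_

-- A record rather than m % 2 ≡ n % 2 itself, so that m and n can be inferred from proofs.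
record _≡₂_ (m n : ℕ) : Set where
  constructor mod₂
  field unmod₂ : m % 2 ≡ n % 2

open _≡₂_

≡₂-isEquivalence : IsEquivalence _≡₂_
≡₂-isEquivalence = record
  { refl  = mod₂ refl
  ; sym   = λ (mod₂ e) → mod₂ (sym e)
  ; trans = λ (mod₂ e) (mod₂ f) → mod₂ (trans e f)
  }

≡₂-setoid : Setoid 0ℓ 0ℓ
≡₂-setoid = record { isEquivalence = ≡₂-isEquivalence }

open IsEquivalence ≡₂-isEquivalence
  using () renaming (refl to ≡₂-refl; sym to ≡₂-sym; trans to ≡₂-trans)

module ≡₂-Reasoning = SetoidReasoning ≡₂-setoid

≡⇒≡₂ : ∀ {m n} → m ≡ n → m ≡₂ n
≡⇒≡₂ refl = ≡₂-refl

+-cong-≡₂ : ∀ {m n o q} → m ≡₂ n → o ≡₂ q → m + o ≡₂ n + q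
+-cong-≡₂ {m} {n} {o} {q} (mod₂ e) (mod₂ f) = mod₂ (begin
  (m + o) % 2          ≡⟨ %-distribˡ-+ m o 2 ⟩
  (m % 2 + o % 2) % 2  ≡⟨ cong₂ (λ x y → (x + y) % 2) e f ⟩
  (n % 2 + q % 2) % 2  ≡⟨ %-distribˡ-+ n q 2 ⟨
  (n + q) % 2          ∎)
  where open ≡-Reasoning

n+n≡₂0 : ∀ n → n + n ≡₂ 0
n+n≡₂0 n = mod₂ (begin
  (n + n) % 2        ≡⟨ cong (λ x → (n + x) % 2) (NP.+-identityʳ n) ⟨
  (n + (n + 0)) % 2  ≡⟨ cong (_% 2) (NP.*-comm 2 n) ⟩
  (0 + n * 2) % 2    ≡⟨ [m+kn]%n≡m%n 0 n 2 ⟩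
  0                  ∎)
  where open ≡-Reasoning

+-cancelʳ-≡₂ : ∀ {m n} o → m + o ≡₂ n + o → m ≡₂ n
+-cancelʳ-≡₂ {m} {n} o e = begin
  m            ≡⟨ NP.+-identityʳ m ⟨
  m + 0        ≈⟨ +-cong-≡₂ ≡₂-refl (≡₂-sym (n+n≡₂0 o)) ⟩
  m + (o + o)  ≡⟨ NP.+-assoc m o o ⟨
  m + o + o    ≈⟨ +-cong-≡₂ e ≡₂-refl ⟩
  n + o + o    ≡⟨ NP.+-assoc n o o ⟩
  n + (o + o)  ≈⟨ +-cong-≡₂ ≡₂-refl (n+n≡₂0 o) ⟩
  n + 0        ≡⟨ NP.+-identityʳ n ⟩
  n            ∎
  where open ≡₂-Reasoning

m+n≡₂0⇒m≡₂n : ∀ {m n} → m + n ≡₂ 0 → m ≡₂ n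
m+n≡₂0⇒m≡₂n {n = n} e = +-cancelʳ-≡₂ n (≡₂-trans e (≡₂-sym (n+n≡₂0 n)))

m≡₂n⇒n∸m≡₂0 : ∀ {m n} → m ≤ n → m ≡₂ n → n ∸ m ≡₂ 0
m≡₂n⇒n∸m≡₂0 {m} m≤n e = +-cancelʳ-≡₂ m (≡₂-trans (≡⇒≡₂ (NP.m∸n+n≡m m≤n)) (≡₂-sym e))

𝟙 : Dec A → ℕ
𝟙 a? = if does a? then 1 else 0

𝟙-cong : A ⇔ B → (a? : Dec A) (b? : Dec B) → 𝟙 a? ≡ 𝟙 b?
𝟙-cong A⇔B a? b? = cong (λ t → if t then 1 else 0) (does-⇔ A⇔B a? b?)

𝟙-yes : (a? : Dec A) → A → 𝟙 a? ≡ 1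
𝟙-yes a? x = cong (λ t → if t then 1 else 0) (dec-true a? x)

𝟙-no : (a? : Dec A) → ¬ A → 𝟙 a? ≡ 0
𝟙-no a? ¬x = cong (λ t → if t then 1 else 0) (dec-false a? ¬x)

𝟙-s≤s : ∀ m n → 𝟙 (suc m N.≤? suc n) ≡ 𝟙 (m N.≤? n)
𝟙-s≤s m n = 𝟙-cong (mk⇔ N.s≤s⁻¹ s≤s) (suc m N.≤? suc n) (m N.≤? n)

length-filter≡sum-𝟙 : {P : Pred A p} (P? : Decidable P) (xs : List A) →
                       length (filter P? xs) ≡ sum (map (𝟙 ∘ P?) xs)
length-filter≡sum-𝟙 P? []       = refl
length-filter≡sum-𝟙 P? (x ∷ xs) with does (P? x)
... | true  = cong suc (length-filter≡sum-𝟙 P? xs)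
... | false = length-filter≡sum-𝟙 P? xs

sum-map-+ : (f g : A → ℕ) (xs : List A) →
            sum (map f xs) + sum (map g xs) ≡ sum (map (λ x → f x + g x) xs)
sum-map-+ f g []       = refl
sum-map-+ f g (x ∷ xs) = trans (interchange (f x) (sum (map f xs)) (g x) (sum (map g xs)))
                               (cong ((f x + g x) +_) (sum-map-+ f g xs))

sum-map-cong-≡₂ : {f g : A → ℕ} {xs : List A} →
                  All (λ x → f x ≡₂ g x) xs → sum (map f xs) ≡₂ sum (map g xs)
sum-map-cong-≡₂ []       = ≡₂-refl
sum-map-cong-≡₂ (e ∷ es) = +-cong-≡₂ e (sum-map-cong-≡₂ es)

-- Counts the positions negated by sgnFlip n k; k = 0 negates as much as k = 1, hence pred k.
sum-𝟙-≤-suc : ∀ n k → sum (tabulate {n = n} (λ i → 𝟙 (k N.≤? suc (toℕ i)))) ≡ n ∸ pred k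
sum-𝟙-≤-suc zero    k       = sym (NP.0∸n≡0 (pred k))
sum-𝟙-≤-suc (suc n) zero    = cong suc (sum-𝟙-≤-suc n zero)
sum-𝟙-≤-suc (suc n) (suc k) = trans (cong (𝟙 (suc k N.≤? 1) +_) (trans
    (cong sum (tabulate-cong {n = n} λ i → 𝟙-s≤s k (suc (toℕ i))))
    (sum-𝟙-≤-suc n k)))
  (head+rest k)
  where
  head+rest : ∀ k → 𝟙 (suc k N.≤? 1) + (n ∸ pred k) ≡ suc n ∸ k
  head+rest zero    = refl
  head+rest (suc k) = refl

1+𝟙[n<m]≡₂𝟙[m<n] : ∀ {m n} → m ≢ n → (n<m? : Dec (n N.< m)) (m<n? : Dec (m N.< n)) →
                    1 + 𝟙 n<m? ≡₂ 𝟙 m<n?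
1+𝟙[n<m]≡₂𝟙[m<n] m≢n (yes n<m) (yes m<n) = ⊥-elim (NP.<-asym n<m m<n)
1+𝟙[n<m]≡₂𝟙[m<n] m≢n (yes _)   (no  _)   = mod₂ refl
1+𝟙[n<m]≡₂𝟙[m<n] m≢n (no  _)   (yes _)   = ≡₂-refl
1+𝟙[n<m]≡₂𝟙[m<n] m≢n (no  n≮m) (no  m≮n) =
  ⊥-elim (m≢n (NP.≤-antisym (NP.≮⇒≥ n≮m) (NP.≮⇒≥ m≮n)))

𝟙-<±-nonneg : ∀ b c → ∣ b ∣ ≢ c → 𝟙 (b ℤ.<? ℤ.+ c) + 𝟙 (b ℤ.<? - ℤ.+ c) ≡₂ 𝟙 (∣ b ∣ N.<? c)
𝟙-<±-nonneg (ℤ.+ x)  zero    _   = ≡₂-refl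
𝟙-<±-nonneg (ℤ.+ x)  (suc c) _   = ≡⇒≡₂ (NP.+-identityʳ _)
𝟙-<±-nonneg -[1+ x ] zero    _   = mod₂ refl
𝟙-<±-nonneg -[1+ x ] (suc c) x≢c = 1+𝟙[n<m]≡₂𝟙[m<n] (x≢c ∘ cong suc) (c N.<? x) (x N.<? c)

𝟙-<± : ∀ a b → ∣ b ∣ ≢ ∣ a ∣ → 𝟙 (b ℤ.<? a) + 𝟙 (b ℤ.<? - a) ≡₂ 𝟙 (∣ b ∣ N.<? ∣ a ∣)
𝟙-<± (ℤ.+ c)  b b≢a = 𝟙-<±-nonneg b c b≢a
𝟙-<± -[1+ c ] b b≢a = ≡₂-trans (≡⇒≡₂ (NP.+-comm (𝟙 (b ℤ.<? -[1+ c ])) (𝟙 (b ℤ.<? +[1+ c ]))))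
                                (𝟙-<±-nonneg b (suc c) b≢a)

𝟙-<0-± : ∀ a → a ≢ 0ℤ → 𝟙 (- a ℤ.<? 0ℤ) + 𝟙 (a ℤ.<? 0ℤ) ≡ 1
𝟙-<0-± (ℤ.+ zero) a≢0 = ⊥-elim (a≢0 refl)
𝟙-<0-± +[1+ m ]   _   = refl
𝟙-<0-± -[1+ m ]   _   = refl

module _ {n : ℕ} where

  pairInversions : Word n → Fin n × Fin n → ℕ
  pairInversions ρ (i , j) = 𝟙 (ρ j ℤ.<? ρ i) + 𝟙 (ρ j ℤ.<? - ρ i)

  negatives : Word n → ℕ
  negatives ρ = length (filter (λ i → ρ i ℤ.<? 0ℤ) (allFin n))

  invB-split : ∀ ρ → invB n ρ ≡ sum (map (pairInversions ρ) (pairs n)) + negatives ρ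
  invB-split ρ = cong (_+ negatives ρ) (trans
    (cong₂ _+_ (length-filter≡sum-𝟙 _ (pairs n)) (length-filter≡sum-𝟙 _ (pairs n)))
    (sum-map-+ _ _ (pairs n)))

  pairs-increasing : All (λ (i , j) → i F.< j) (pairs n)
  pairs-increasing = all-filter (λ (i , j) → i FP.<? j)
    (concatMap (λ i → map (i ,_) (allFin n)) (allFin n))

module _ {n : ℕ} (k : ℕ) (ρ : Word n) where

  private
    ρ′ : Word n
    ρ′ = sgnFlip n k ρ

  ∣sgnFlip∣ : ∀ i → ∣ ρ′ i ∣ ≡ ∣ ρ i ∣
  ∣sgnFlip∣ i with k N.≤? suc (toℕ i)
  ... | yes _ = ℤP.∣-i∣≡∣i∣ (ρ i)
  ... | no  _ = refl

  𝟙-<0-sgnFlip : ∀ i → ρ i ≢ 0ℤ →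
                 𝟙 (ρ′ i ℤ.<? 0ℤ) + 𝟙 (ρ i ℤ.<? 0ℤ) ≡₂ 𝟙 (k N.≤? suc (toℕ i))
  𝟙-<0-sgnFlip i ρi≢0 with k N.≤? suc (toℕ i)
  ... | yes k≤1+i = ≡⇒≡₂ (trans (𝟙-<0-± (ρ i) ρi≢0) (sym (𝟙-yes (k N.≤? suc (toℕ i)) k≤1+i)))
  ... | no  k≰1+i = ≡₂-trans (n+n≡₂0 (𝟙 (ρ i ℤ.<? 0ℤ))) (≡⇒≡₂ (sym (𝟙-no (k N.≤? suc (toℕ i)) k≰1+i)))

  negatives-sgnFlip : (∀ i → ρ i ≢ 0ℤ) → negatives ρ′ + negatives ρ ≡₂ n ∸ pred k
  negatives-sgnFlip ρ≢0 = begin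
    negatives ρ′ + negatives ρ
      ≡⟨ cong₂ _+_ (length-filter≡sum-𝟙 _ (allFin n)) (length-filter≡sum-𝟙 _ (allFin n)) ⟩
    sum (map (𝟙 ∘ (ℤ._<? 0ℤ) ∘ ρ′) (allFin n)) + sum (map (𝟙 ∘ (ℤ._<? 0ℤ) ∘ ρ) (allFin n))
      ≡⟨ sum-map-+ _ _ (allFin n) ⟩
    sum (map (λ i → 𝟙 (ρ′ i ℤ.<? 0ℤ) + 𝟙 (ρ i ℤ.<? 0ℤ)) (allFin n))
      ≈⟨ sum-map-cong-≡₂ (All.universal (λ i → 𝟙-<0-sgnFlip i (ρ≢0 i)) (allFin n)) ⟩
    sum (map (λ i → 𝟙 (k N.≤? suc (toℕ i))) (allFin n))
      ≡⟨ cong sum (map-tabulate {n = n} id (λ i → 𝟙 (k N.≤? suc (toℕ i)))) ⟩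
    sum (tabulate {n = n} (λ i → 𝟙 (k N.≤? suc (toℕ i))))
      ≡⟨ sum-𝟙-≤-suc n k ⟩
    n ∸ pred k ∎
    where open ≡₂-Reasoning

  pairInversions-sgnFlip : (∀ {i j} → i ≢ j → ∣ ρ i ∣ ≢ ∣ ρ j ∣) →
    sum (map (pairInversions ρ′) (pairs n)) ≡₂ sum (map (pairInversions ρ) (pairs n))
  pairInversions-sgnFlip ∣ρ∣-injective = sum-map-cong-≡₂ (All.map pair pairs-increasing)
    where
    pair : ∀ {p} → proj₁ p F.< proj₂ p → pairInversions ρ′ p ≡₂ pairInversions ρ p
    pair {i , j} i<j = begin
      pairInversions ρ′ (i , j)   ≈⟨ 𝟙-<± (ρ′ i) (ρ′ j) ∣ρ′j∣≢∣ρ′i∣ ⟩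
      𝟙 (∣ ρ′ j ∣ N.<? ∣ ρ′ i ∣)  ≡⟨ cong₂ (λ x y → 𝟙 (x N.<? y)) (∣sgnFlip∣ j) (∣sgnFlip∣ i) ⟩
      𝟙 (∣ ρ j ∣ N.<? ∣ ρ i ∣)    ≈⟨ ≡₂-sym (𝟙-<± (ρ i) (ρ j) ∣ρj∣≢∣ρi∣) ⟩
      pairInversions ρ (i , j)    ∎
      where
      open ≡₂-Reasoning
      ∣ρj∣≢∣ρi∣ : ∣ ρ j ∣ ≢ ∣ ρ i ∣
      ∣ρj∣≢∣ρi∣ = ∣ρ∣-injective (FP.<⇒≢ i<j ∘ sym)
      ∣ρ′j∣≢∣ρ′i∣ : ∣ ρ′ j ∣ ≢ ∣ ρ′ i ∣
      ∣ρ′j∣≢∣ρ′i∣ = ∣ρj∣≢∣ρi∣ ∘ subst₂ _≡_ (∣sgnFlip∣ j) (∣sgnFlip∣ i)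

  invB-sgnFlip : (∀ i → ρ i ≢ 0ℤ) → (∀ {i j} → i ≢ j → ∣ ρ i ∣ ≢ ∣ ρ j ∣) →
                 n ∸ pred k ≡₂ 0 → invB n ρ′ ≡₂ invB n ρ
  invB-sgnFlip ρ≢0 ∣ρ∣-injective flips-even = begin
    invB n ρ′                                                   ≡⟨ invB-split ρ′ ⟩
    sum (map (pairInversions ρ′) (pairs n)) + negatives ρ′
      ≈⟨ +-cong-≡₂ (pairInversions-sgnFlip ∣ρ∣-injective)
                   (m+n≡₂0⇒m≡₂n (≡₂-trans (negatives-sgnFlip ρ≢0) flips-even)) ⟩
    sum (map (pairInversions ρ) (pairs n)) + negatives ρ        ≡⟨ invB-split ρ ⟨
    invB n ρ                                                    ∎
    where open ≡₂-Reasoning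

signedPerm-nonzero : ∀ {n} (π : Word n) → IsSignedPerm n π → ∀ i → π i ≢ 0ℤ
signedPerm-nonzero π (_ , ∣π∣≡ , _) i πi≡0 = NP.0≢1+n (trans (cong ∣_∣ (sym πi≡0)) (∣π∣≡ i))

signedPerm-∣∣-injective : ∀ {n} (π : Word n) → IsSignedPerm n π →
                          ∀ {i j} → i ≢ j → ∣ π i ∣ ≢ ∣ π j ∣
signedPerm-∣∣-injective π (σ , ∣π∣≡ , σ-injective , _) {i} {j} i≢j ∣πi∣≡∣πj∣ =
  i≢j (σ-injective i j (FP.toℕ-injective (NP.suc-injective
    (trans (sym (∣π∣≡ i)) (trans ∣πi∣≡∣πj∣ (∣π∣≡ j))))))

lemma10 : (n : ℕ) → 1 ≤ n → (π : Word n) → IsSignedPerm n π →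
          (k : ℕ) → InT n k →
          invB n (sgnFlip n k π) % 2 ≡ invB n π % 2
lemma10 n _ π π-perm zero    (() , _)
lemma10 n _ π π-perm (suc k) (_ , 2+k≤n , 1+k%2≡[n+1]%2) = unmod₂
  (invB-sgnFlip (suc k) π (signedPerm-nonzero π π-perm)
                (signedPerm-∣∣-injective π π-perm) flips-even)
  where
  k≤n : k ≤ n
  k≤n = NP.≤-trans (NP.n≤1+n k) (NP.<⇒≤ 2+k≤n)
  k≡₂n : k ≡₂ n
  k≡₂n = +-cancelʳ-≡₂ 1 (≡₂-trans (≡⇒≡₂ (NP.+-comm k 1)) (mod₂ 1+k%2≡[n+1]%2))
  flips-even : n ∸ k ≡₂ 0
  flips-even = m≡₂n⇒n∸m≡₂0 k≤n k≡₂n
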